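{- Let $I=(U_1,\dots,U_p,\mathcal{S},k)$ be an instance of RP-$d$-SP such that $\mathcal{S}$ has a hitting set of size at most $k\cdot d$. Suppose that for some agent $i\in[p]$ there is a sunflower $\mathcal{F}\subseteq\mathcal{S}[U_i]$ consisting of $d(k\cdot d-1)+2$ sets, and let $F\in\mathcal{F}$ be a set of minimum size in $\mathcal{F}$. Then $I$ is a YES-instance if and only if $I'=(U_1,\dots,U_p,\mathcal{S}\setminus\{F\},k)$ is a YES-instance. (That is, Reduction Rule 1, which removes such a set $F$, is safe.)
   Context: An instance of RP-$d$-SP consists of a finite universe $U=U_1\cup\dots\cup U_p$ partitioned among $p$ agents, a collection $\mathcal{S}\subseteq 2^U$ of sets each of size at most $d$, and an integer $k$. For $U'\subseteq U$, $\mathcal{S}[U']$ denotes the sets of $\mathcal{S}$ contained in $U'$. A set $S$ is $i$-internal if $S\subseteq U_i$. For a collection $\mathcal{X}\subseteq\mathcal{S}$ of pairwise disjoint sets, agent $i$ rejects $\mathcal{X}$ if there exist $\mathcal{X}_{\mathrm{rej}}\subseteq\mathcal{X}$ and a collection $\mathcal{X}_{\mathrm{int}}\subseteq\mathcal{S}$ of $i$-internal sets such that $(\mathcal{X}\setminus\mathcal{X}_{\mathrm{rej}})\cup\mathcal{X}_{\mathrm{int}}$ consists of pairwise disjoint sets and covers more elements of $U_i$ than $\mathcal{X}$ does; $\mathcal{X}$ is rejection-proof if no agent rejects it. The instance is a YES-instance if there is a rejection-proof collection of pairwise disjoint sets from $\mathcal{S}$ covering at least $k$ elements. A hitting set of $\mathcal{S}$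 is a subset of $U$ meeting every set of $\mathcal{S}$. A sunflower with core $Y$ is a collection of sets whose pairwise intersections all equal $Y$, with all petals $S\setminus Y$ non-empty. -}

module Defs where

open import Data.Nat using (ℕ; _≤_; _<_; _≥_; _*_; _+_; _∸_)
open import Data.Bool using (Bool)
import Data.Bool.Properties as BoolP
open import Data.Fin using (Fin)
import Data.Fin.Properties as FinP
open import Data.Fin.Subset as Sub using (Subset; ∣_∣; ⋃; _∩_; _⊆_)
open import Data.Vec using (tabulate)
import Data.Vec.Properties as VecP
open import Data.List using (List; filter; _++_; length)
open import Data.List.Relation.Unary.All using (All)
open import Data.List.Relation.Unary.Unique.Propositional using (Unique)
open import Data.List.Membership.Propositional using (_∈_)
import Data.List.Membership.DecPropositional as DecMem
open import Data.Product using (Σ; ∃; _×_)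
open import Relation.Binary.PropositionalEquality using (_≡_; _≢_)
open import Relation.Binary.Definitions using (DecidableEquality)
open import Relation.Nullary using (¬_)
open import Relation.Nullary.Decidable using (⌊_⌋; ¬?)
open import Data.Empty using (⊥)

_≟ˢ_ : ∀ {n} → DecidableEquality (Subset n)
_≟ˢ_ = VecP.≡-dec BoolP._≟_

-- An instance of RP-d-SP: the universe is Fin n; the partition into
-- U_1,…,U_p is given by an owner function Fin n → Fin p (element x lies
-- in U_(owner x)); 𝒮 is a finite collection of subsets of the universe,
-- given as a list (interpreted as the set of its members); k is the target.
record Instance : Set where
  constructor mkInstance
  field
    n     : ℕ
    p     : ℕ
    owner : Fin n → Fin p
    𝒮     : List (Subset n)
    k     : ℕ
open Instance public

Part : (I : Instance) → Fin (p I) → Subset (n I)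
Part I i = tabulate (λ x → ⌊ owner I x FinP.≟ i ⌋)

SizeBounded : ℕ → Instance → Set
SizeBounded d I = All (λ S → ∣ S ∣ ≤ d) (𝒮 I)

Disjoint : ∀ {n} → Subset n → Subset n → Set
Disjoint A B = ∀ x → x Sub.∈ A → x Sub.∈ B → ⊥

PairwiseDisjoint : ∀ {n} → List (Subset n) → Set
PairwiseDisjoint X = ∀ A B → A ∈ X → B ∈ X → A ≢ B → Disjoint A B

_⊆ᶜ_ : ∀ {n} → List (Subset n) → List (Subset n) → Set
X ⊆ᶜ Y = All (_∈ Y) X

_∖ᶜ_ : ∀ {n} → List (Subset n) → List (Subset n) → List (Subset n)
X ∖ᶜ Y = filter (λ S → ¬? (S ∈? Y)) X
  where open DecMem _≟ˢ_

covᵢ : (I : Instance) → Fin (p I) → List (Subset (n I)) → ℕ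
covᵢ I i X = ∣ ⋃ X ∩ Part I i ∣

Internal : (I : Instance) → Fin (p I) → Subset (n I) → Set
Internal I i S = S ⊆ Part I i

Rejects : (I : Instance) → Fin (p I) → List (Subset (n I)) → Set
Rejects I i X =
  Σ (List (Subset (n I))) λ Xrej → Xrej ⊆ᶜ X ×
  Σ (List (Subset (n I))) λ Xint →
    All (λ S → S ∈ 𝒮 I × Internal I i S) Xint ×
    PairwiseDisjoint ((X ∖ᶜ Xrej) ++ Xint) ×
    covᵢ I i X < covᵢ I i ((X ∖ᶜ Xrej) ++ Xint)

RejectionProof : (I : Instance) → List (Subset (n I)) → Set
RejectionProof I X = ∀ i → ¬ Rejects I i X

YesInstance : Instance → Set
YesInstance I =
  Σ (List (Subset (n I))) λ X →
    X ⊆ᶜ 𝒮 I × PairwiseDisjoint X × RejectionProof I X × ∣ ⋃ X ∣ ≥ k I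

HittingSet : (I : Instance) → Subset (n I) → Set
HittingSet I H = All (λ S → Sub.Nonempty (S ∩ H)) (𝒮 I)

SunflowerWithCore : ∀ {n} → List (Subset n) → Subset n → Set
SunflowerWithCore ℱ Y =
  Unique ℱ ×
  (∀ A B → A ∈ ℱ → B ∈ ℱ → A ≢ B → A ∩ B ≡ Y) ×
  All (λ A → ∃ λ x → x Sub.∈ A × x Sub.∉ Y) ℱ

Sunflower : ∀ {n} → List (Subset n) → Set
Sunflower {n} ℱ = Σ (Subset n) (SunflowerWithCore ℱ)

InRestriction : (I : Instance) → Fin (p I) → List (Subset (n I)) → Set
InRestriction I i ℱ = All (λ S → S ∈ 𝒮 I × S ⊆ Part I i) ℱ

MinIn : ∀ {n} → Subset n → List (Subset n) → Set
MinIn F ℱ = F ∈ ℱ × All (λ A → ∣ F ∣ ≤ ∣ A ∣) ℱ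

removeSet : (I : Instance) → Subset (n I) → Instance
removeSet (mkInstance n p owner 𝒮 k) F =
  mkInstance n p owner (filter (λ S → ¬? (S ≟ˢ F)) 𝒮) k

-- A pairwise disjoint collection that contains F (a solution, or the outcome of a rejection) can
-- trade F for a petal F′ ≠ F of the sunflower that is disjoint from all its other sets: F′ is i-internal and no smaller than F, so the trade
-- keeps the sets pairwise disjoint and covers at least as much of every part Uⱼ. Such a petal
-- exists by counting. The other sets G of a pairwise disjoint collection containing F avoid F, and
-- petals meet only inside the core ⊆ F, so every point of a G lies in at most one petal besides F.
-- The G are hit by the at most kd − 1 points of H outside F (one point of H lies in F), so they
-- cover at most d(kd − 1) points and meet at most d(kd − 1) of the d(kd − 1) + 1 other petals.
-- A solution of I using F thus becomes one of I′ after the trade, a rejection in I that adds F as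
-- an internal set becomes a rejection in I′ adding F′ instead, and a rejection of the traded
-- solution in I′ pulls back to a rejection of the original one in I.

module Submission where

open import Defs
open import Data.Nat using (ℕ; suc; _≤_; _<_; _*_; _+_; _∸_; z≤n; s≤s)
open import Data.Nat.Properties
open import Data.Bool using (true; false)
open import Data.Bool.Properties using (T-≡)
open import Data.Fin using (Fin)
import Data.Fin.Properties as FinP
open import Data.Fin.Subset
  using (Subset; ∣_∣; ⋃; _∩_; _∪_; _─_; _-_; Nonempty; _⊆_)
  renaming (_∈_ to _∈ₛ_; _∉_ to _∉ₛ_)
open import Data.Fin.Subset.Properties
open import Data.Vec using ([]; _∷_; here; there)
open import Data.Vec.Properties using ([]=⇒lookup; lookup∘tabulate)
open import Data.List using (List; []; _∷_; length; filter; _++_)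
open import Data.List.Properties using (filter-accept; filter-reject; filter-all)
open import Data.List.Membership.Propositional using (_∈_; _∉_; find)
open import Data.List.Membership.Propositional.Properties
  using (∈-filter⁺; ∈-filter⁻; ∈-++⁺ˡ; ∈-++⁺ʳ; ∈-++⁻)
import Data.List.Membership.DecPropositional as DecMembership
open import Data.List.Relation.Binary.Subset.Propositional using () renaming (_⊆_ to _⊆ˡ_)
open import Data.List.Relation.Unary.Any using (here; there)
open import Data.List.Relation.Unary.All as All using (All; _∷_; all?)
open import Data.List.Relation.Unary.All.Properties using (¬All⇒Any¬)
open import Data.List.Relation.Unary.AllPairs using (_∷_)
open import Data.List.Relation.Unary.Unique.Propositional using (Unique)
import Data.List.Relation.Unary.Unique.Propositional.Properties as Unique
open import Data.Product using (Σ; ∃; _×_; _,_; proj₁; proj₂; map₁)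
open import Data.Sum as Sum using (_⊎_; inj₁; inj₂)
open import Data.Empty using (⊥-elim)
open import Function using (_∘_)
open import Function.Bundles using (_⇔_; mk⇔; Equivalence)
open import Relation.Binary.PropositionalEquality
open import Relation.Nullary using (Dec; yes; no)
open import Relation.Nullary.Decidable using (⌊_⌋; ¬?; toWitness; decidable-stable)

∣p∣≡∣p∩q∣+∣p─q∣ : ∀ {n} (p q : Subset n) → ∣ p ∣ ≡ ∣ p ∩ q ∣ + ∣ p ─ q ∣
∣p∣≡∣p∩q∣+∣p─q∣ []          []          = refl
∣p∣≡∣p∩q∣+∣p─q∣ (true ∷ p)  (true ∷ q)  = cong suc (∣p∣≡∣p∩q∣+∣p─q∣ p q)
∣p∣≡∣p∩q∣+∣p─q∣ (true ∷ p)  (false ∷ q) =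
  trans (cong suc (∣p∣≡∣p∩q∣+∣p─q∣ p q)) (sym (+-suc _ _))
∣p∣≡∣p∩q∣+∣p─q∣ (false ∷ p) (true ∷ q)  = ∣p∣≡∣p∩q∣+∣p─q∣ p q
∣p∣≡∣p∩q∣+∣p─q∣ (false ∷ p) (false ∷ q) = ∣p∣≡∣p∩q∣+∣p─q∣ p q

∣p∪q∣≤∣p∣+∣q∣ : ∀ {n} (p q : Subset n) → ∣ p ∪ q ∣ ≤ ∣ p ∣ + ∣ q ∣
∣p∪q∣≤∣p∣+∣q∣ []          []          = z≤n
∣p∪q∣≤∣p∣+∣q∣ (true ∷ p)  (true ∷ q)  =
  s≤s (≤-trans (∣p∪q∣≤∣p∣+∣q∣ p q) (+-monoʳ-≤ ∣ p ∣ (n≤1+n ∣ q ∣)))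
∣p∪q∣≤∣p∣+∣q∣ (true ∷ p)  (false ∷ q) = s≤s (∣p∪q∣≤∣p∣+∣q∣ p q)
∣p∪q∣≤∣p∣+∣q∣ (false ∷ p) (true ∷ q)  =
  subst (suc ∣ p ∪ q ∣ ≤_) (sym (+-suc ∣ p ∣ ∣ q ∣)) (s≤s (∣p∪q∣≤∣p∣+∣q∣ p q))
∣p∪q∣≤∣p∣+∣q∣ (false ∷ p) (false ∷ q) = ∣p∪q∣≤∣p∣+∣q∣ p q

∣p∣≤∣q∣-by-exchange : ∀ {n} {p q r r′ : Subset n} →
  p ⊆ r ∪ (q ─ r′) → r′ ⊆ q → ∣ r ∣ ≤ ∣ r′ ∣ → ∣ p ∣ ≤ ∣ q ∣
∣p∣≤∣q∣-by-exchange {p = p} {q} {r} {r′} p⊆ r′⊆q ∣r∣≤∣r′∣ = begin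
  ∣ p ∣                     ≤⟨ p⊆q⇒∣p∣≤∣q∣ p⊆ ⟩
  ∣ r ∪ (q ─ r′) ∣          ≤⟨ ∣p∪q∣≤∣p∣+∣q∣ r (q ─ r′) ⟩
  ∣ r ∣ + ∣ q ─ r′ ∣        ≤⟨ +-monoˡ-≤ ∣ q ─ r′ ∣ ∣r∣≤∣r′∣ ⟩
  ∣ r′ ∣ + ∣ q ─ r′ ∣       ≤⟨ +-monoˡ-≤ ∣ q ─ r′ ∣ (p⊆q⇒∣p∣≤∣q∣ r′⊆q∩r′) ⟩
  ∣ q ∩ r′ ∣ + ∣ q ─ r′ ∣   ≡⟨ ∣p∣≡∣p∩q∣+∣p─q∣ q r′ ⟨
  ∣ q ∣                     ∎
  where
  open ≤-Reasoning
  r′⊆q∩r′ : r′ ⊆ q ∩ r′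
  r′⊆q∩r′ x∈r′ = x∈p∩q⁺ (r′⊆q x∈r′ , x∈r′)

Disjoint-sym : ∀ {n} {A B : Subset n} → Disjoint A B → Disjoint B A
Disjoint-sym A∩B=∅ x x∈B x∈A = A∩B=∅ x x∈A x∈B

x∈⋃⁺ : ∀ {n} {C : List (Subset n)} {G x} → G ∈ C → x ∈ₛ G → x ∈ₛ ⋃ C
x∈⋃⁺ (here refl) x∈G = x∈p∪q⁺ (inj₁ x∈G)
x∈⋃⁺ (there G∈C) x∈G = x∈p∪q⁺ (inj₂ (x∈⋃⁺ G∈C x∈G))

x∈⋃⁻ : ∀ {n} (C : List (Subset n)) {x} → x ∈ₛ ⋃ C → ∃ λ G → G ∈ C × x ∈ₛ G
x∈⋃⁻ []      x∈⊥ = ⊥-elim (∉⊥ x∈⊥)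
x∈⋃⁻ (G ∷ C) x∈⋃ with x∈p∪q⁻ G (⋃ C) x∈⋃
... | inj₁ x∈G = G , here refl , x∈G
... | inj₂ x∈⋃C with x∈⋃⁻ C x∈⋃C
...   | G′ , G′∈C , x∈G′ = G′ , there G′∈C , x∈G′

∣⋃∩∣-mono : ∀ {n} {C C′ : List (Subset n)} {P : Subset n} →
  (∀ {G} → G ∈ C → G ∈ C′ ⊎ Disjoint G P) → ∣ ⋃ C ∩ P ∣ ≤ ∣ ⋃ C′ ∩ P ∣
∣⋃∩∣-mono {C = C} {C′} {P} C⊆C′ = p⊆q⇒∣p∣≤∣q∣ ⋃C∩P⊆⋃C′∩P
  where
  ⋃C∩P⊆⋃C′∩P : ⋃ C ∩ P ⊆ ⋃ C′ ∩ P
  ⋃C∩P⊆⋃C′∩P x∈ with x∈p∩q⁻ (⋃ C) P x∈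
  ... | x∈⋃C , x∈P with x∈⋃⁻ C x∈⋃C
  ...   | G , G∈C , x∈G with C⊆C′ G∈C
  ...     | inj₁ G∈C′    = x∈p∩q⁺ (x∈⋃⁺ G∈C′ x∈G , x∈P)
  ...     | inj₂ G∩P=∅  = ⊥-elim (G∩P=∅ _ x∈G x∈P)

∣⋃∩∣-exchange : ∀ {n} {C C′ : List (Subset n)} {F F′ P : Subset n} →
  (∀ {G} → G ∈ C → G ≢ F → Disjoint G F′) → C ⊆ˡ F ∷ C′ →
  F′ ∈ C′ → F′ ⊆ P → ∣ F ∣ ≤ ∣ F′ ∣ → ∣ ⋃ C ∩ P ∣ ≤ ∣ ⋃ C′ ∩ P ∣
∣⋃∩∣-exchange {C = C} {C′} {F} {F′} {P} avoids C⊆ F′∈C′ F′⊆P =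
  ∣p∣≤∣q∣-by-exchange ⋃C∩P⊆ F′⊆⋃C′∩P
  where
  F′⊆⋃C′∩P : F′ ⊆ ⋃ C′ ∩ P
  F′⊆⋃C′∩P x∈F′ = x∈p∩q⁺ (x∈⋃⁺ F′∈C′ x∈F′ , F′⊆P x∈F′)
  ⋃C∩P⊆ : ⋃ C ∩ P ⊆ F ∪ ((⋃ C′ ∩ P) ─ F′)
  ⋃C∩P⊆ x∈ with x∈p∩q⁻ (⋃ C) P x∈
  ... | x∈⋃C , x∈P with x∈⋃⁻ C x∈⋃C
  ...   | G , G∈C , x∈G with G ≟ˢ F | C⊆ G∈C
  ...     | yes refl | _            = x∈p∪q⁺ (inj₁ x∈G)
  ...     | no G≢F   | here G≡F     = ⊥-elim (G≢F G≡F)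
  ...     | no G≢F   | there G∈C′   = x∈p∪q⁺ (inj₂ (x∈p∧x∉q⇒x∈p─q
      (x∈p∩q⁺ (x∈⋃⁺ G∈C′ x∈G , x∈P)) (avoids G∈C G≢F _ x∈G)))

PairwiseDisjoint-mono : ∀ {n} {C C′ : List (Subset n)} →
  C′ ⊆ˡ C → PairwiseDisjoint C → PairwiseDisjoint C′
PairwiseDisjoint-mono C′⊆C disjoint A B A∈C′ B∈C′ = disjoint A B (C′⊆C A∈C′) (C′⊆C B∈C′)

PairwiseDisjoint-exchange : ∀ {n} {C C′ : List (Subset n)} {F F′ : Subset n} →
  PairwiseDisjoint C → (∀ {G} → G ∈ C → G ≢ F → Disjoint G F′) →
  C′ ⊆ˡ F′ ∷ C → F ∉ C′ → PairwiseDisjoint C′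
PairwiseDisjoint-exchange {C′ = C′} disjoint avoids C′⊆ F∉C′ A B A∈C′ B∈C′ A≢B
  with C′⊆ A∈C′ | C′⊆ B∈C′
... | here refl | here refl = ⊥-elim (A≢B refl)
... | here refl | there B∈C = Disjoint-sym (avoids B∈C λ { refl → F∉C′ B∈C′ })
... | there A∈C | here refl = avoids A∈C λ { refl → F∉C′ A∈C′ }
... | there A∈C | there B∈C = disjoint A B A∈C B∈C A≢B

_─ᶜ_ : ∀ {n} → List (Subset n) → Subset n → List (Subset n)
C ─ᶜ F = filter (λ S → ¬? (S ≟ˢ F)) C

∈-─ᶜ⁻ : ∀ {n} {C : List (Subset n)} {F G} → G ∈ C ─ᶜ F → G ∈ C × G ≢ F
∈-─ᶜ⁻ {F = F} = ∈-filter⁻ (λ S → ¬? (S ≟ˢ F))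

∈-─ᶜ⁺ : ∀ {n} {C : List (Subset n)} {F G} → G ∈ C → G ≢ F → G ∈ C ─ᶜ F
∈-─ᶜ⁺ {F = F} = ∈-filter⁺ (λ S → ¬? (S ≟ˢ F))

length-─ᶜ : ∀ {n} {C : List (Subset n)} {F} → Unique C → F ∈ C → length C ≡ suc (length (C ─ᶜ F))
length-─ᶜ {C = F ∷ C} {F} (F∉C ∷ _) (here refl)
  rewrite filter-reject (λ S → ¬? (S ≟ˢ F)) {xs = C} (λ F≢F → F≢F refl)
        | filter-all (λ S → ¬? (S ≟ˢ F)) (All.map ≢-sym F∉C) = refl
length-─ᶜ {C = G ∷ C} {F} (G∉C ∷ unique) (there F∈C)
  rewrite filter-accept (λ S → ¬? (S ≟ˢ F)) {xs = C} (All.lookup G∉C F∈C) =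
    cong suc (length-─ᶜ unique F∈C)

_∈ᶜ?_ : ∀ {n} (S : Subset n) (C : List (Subset n)) → Dec (S ∈ C)
_∈ᶜ?_ = DecMembership._∈?_ _≟ˢ_

∈-∖ᶜ⁻ : ∀ {n} {X Y : List (Subset n)} {G} → G ∈ (X ∖ᶜ Y) → G ∈ X × G ∉ Y
∈-∖ᶜ⁻ {Y = Y} = ∈-filter⁻ (λ S → ¬? (S ∈ᶜ? Y))

∈-∖ᶜ⁺ : ∀ {n} {X Y : List (Subset n)} {G} → G ∈ X → G ∉ Y → G ∈ X ∖ᶜ Y
∈-∖ᶜ⁺ {Y = Y} = ∈-filter⁺ (λ S → ¬? (S ∈ᶜ? Y))

∖ᶜ-⊆ᶜ : ∀ {n} (X Y : List (Subset n)) → (X ∖ᶜ Y) ⊆ᶜ X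
∖ᶜ-⊆ᶜ X Y = All.tabulate (proj₁ ∘ ∈-∖ᶜ⁻ {Y = Y})

∈-∖ᶜ-∖ᶜ⁻ : ∀ {n} {X K : List (Subset n)} {G} → G ∈ (X ∖ᶜ (X ∖ᶜ K)) → G ∈ K
∈-∖ᶜ-∖ᶜ⁻ {X = X} {K} {G} G∈ = decidable-stable (G ∈ᶜ? K) λ G∉K →
  G∉X∖K (∈-∖ᶜ⁺ {Y = K} G∈X G∉K)
  where
  G∈X = proj₁ (∈-∖ᶜ⁻ {X = X} {Y = X ∖ᶜ K} G∈)
  G∉X∖K = proj₂ (∈-∖ᶜ⁻ {X = X} {Y = X ∖ᶜ K} G∈)

∈-∖ᶜ-∖ᶜ⁺ : ∀ {n} {X K : List (Subset n)} {G} → G ∈ X → G ∈ K → G ∈ (X ∖ᶜ (X ∖ᶜ K))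
∈-∖ᶜ-∖ᶜ⁺ {X = X} {K} G∈X G∈K =
  ∈-∖ᶜ⁺ G∈X (λ G∈X∖K → proj₂ (∈-∖ᶜ⁻ {X = X} {Y = K} G∈X∖K) G∈K)

owner-∈Part : ∀ (I : Instance) {i x} → x ∈ₛ Part I i → owner I x ≡ i
owner-∈Part I {i} {x} x∈Uᵢ = toWitness {a? = owner I x FinP.≟ i} (Equivalence.from T-≡
  (trans (sym (lookup∘tabulate (λ y → ⌊ owner I y FinP.≟ i ⌋) x)) ([]=⇒lookup x∈Uᵢ)))

∈Part-unique : ∀ (I : Instance) {i j x} → x ∈ₛ Part I i → x ∈ₛ Part I j → i ≡ j
∈Part-unique I x∈Uᵢ x∈Uⱼ = trans (sym (owner-∈Part I x∈Uᵢ)) (owner-∈Part I x∈Uⱼ)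

Internal⇒Disjoint : ∀ (I : Instance) {i j S} → Internal I i S → i ≢ j → Disjoint S (Part I j)
Internal⇒Disjoint I S⊆Uᵢ i≢j x x∈S x∈Uⱼ = i≢j (∈Part-unique I (S⊆Uᵢ x∈S) x∈Uⱼ)

Nonempty-∩-comm : ∀ {n} {p q : Subset n} → Nonempty (p ∩ q) → Nonempty (q ∩ p)
Nonempty-∩-comm {p = p} {q} (x , x∈p∩q) = x , subst (x ∈ₛ_) (∩-comm p q) x∈p∩q

Nonempty-∩-─ : ∀ {n} {G H F : Subset n} → Disjoint G F → Nonempty (G ∩ H) → Nonempty (G ∩ (H ─ F))
Nonempty-∩-─ {G = G} {H} G∩F=∅ (x , x∈G∩H) =
  let x∈G , x∈H = x∈p∩q⁻ G H x∈G∩H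
  in x , x∈p∩q⁺ (x∈G , x∈p∧x∉q⇒x∈p─q x∈H (G∩F=∅ x x∈G))

∣⋃∣≤d*∣H∣ : ∀ {n} d (H : Subset n) (C : List (Subset n)) → PairwiseDisjoint C →
  All (λ G → ∣ G ∣ ≤ d × Nonempty (G ∩ H)) C → ∣ ⋃ C ∣ ≤ d * ∣ H ∣
∣⋃∣≤d*∣H∣ {n} d H [] _ _ = ≤-trans (≤-reflexive (∣⊥∣≡0 n)) z≤n
∣⋃∣≤d*∣H∣ d H (G ∷ C) disjoint ((∣G∣≤d , G∩H≠∅) ∷ hit) with G ∈ᶜ? C
... | yes G∈C = ≤-trans (p⊆q⇒∣p∣≤∣q∣ G∪⋃C⊆⋃C) (∣⋃∣≤d*∣H∣ d H C disjointC hit)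
  where
  disjointC = PairwiseDisjoint-mono there disjoint
  G∪⋃C⊆⋃C : G ∪ ⋃ C ⊆ ⋃ C
  G∪⋃C⊆⋃C x∈ with x∈p∪q⁻ G (⋃ C) x∈
  ... | inj₁ x∈G  = x∈⋃⁺ G∈C x∈G
  ... | inj₂ x∈⋃C = x∈⋃C
... | no G∉C = begin
  ∣ G ∪ ⋃ C ∣              ≤⟨ ∣p∪q∣≤∣p∣+∣q∣ G (⋃ C) ⟩
  ∣ G ∣ + ∣ ⋃ C ∣          ≤⟨ +-mono-≤ ∣G∣≤d (∣⋃∣≤d*∣H∣ d (H ─ G) C disjointC hit′) ⟩
  d + d * ∣ H ─ G ∣        ≡⟨ *-suc d ∣ H ─ G ∣ ⟨
  d * suc ∣ H ─ G ∣        ≤⟨ *-monoʳ-≤ d (p∩q≢∅⇒∣p─q∣<∣p∣ H G (Nonempty-∩-comm G∩H≠∅)) ⟩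
  d * ∣ H ∣                ∎
  where
  open ≤-Reasoning
  disjointC = PairwiseDisjoint-mono there disjoint
  hit′ : All (λ B → ∣ B ∣ ≤ d × Nonempty (B ∩ (H ─ G))) C
  hit′ = All.tabulate λ {B} B∈C →
    let ∣B∣≤d , B∩H≠∅ = All.lookup hit B∈C
        G∩B=∅ = disjoint G B (here refl) (there B∈C) (λ { refl → G∉C B∈C })
    in ∣B∣≤d , Nonempty-∩-─ (Disjoint-sym G∩B=∅) B∩H≠∅

length-petals≤∣W∣ : ∀ {n} (F W : Subset n) (ℒ : List (Subset n)) → Unique ℒ →
  (∀ {A B} → A ∈ ℒ → B ∈ ℒ → A ≢ B → A ∩ B ⊆ F) → Disjoint W F →
  All (λ A → Nonempty (A ∩ W)) ℒ → length ℒ ≤ ∣ W ∣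
length-petals≤∣W∣ F W []      _ _ _ _ = z≤n
length-petals≤∣W∣ F W (A ∷ ℒ) (A∉ℒ ∷ unique) meetInF W∩F=∅ ((x , x∈A∩W) ∷ meetW) =
  ≤-trans (s≤s (length-petals≤∣W∣ F (W - x) ℒ unique (λ A∈ B∈ → meetInF (there A∈) (there B∈))
                  (λ y y∈W-x → W∩F=∅ y (p─q⊆p W _ y∈W-x)) meetW-x))
          (x∈p⇒∣p-x∣<∣p∣ x∈W)
  where
  x∈A = proj₁ (x∈p∩q⁻ A W x∈A∩W)
  x∈W = proj₂ (x∈p∩q⁻ A W x∈A∩W)
  meetW-x : All (λ B → Nonempty (B ∩ (W - x))) ℒ
  meetW-x = All.tabulate λ {B} B∈ℒ →
    let y , y∈B∩W = All.lookup meetW B∈ℒ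
        y∈B , y∈W = x∈p∩q⁻ B W y∈B∩W
        y≢x : y ≢ x
        y≢x = λ { refl → W∩F=∅ y y∈W
                  (meetInF (here refl) (there B∈ℒ) (All.lookup A∉ℒ B∈ℒ) (x∈p∩q⁺ (x∈A , y∈B))) }
    in y , x∈p∩q⁺ (y∈B , x∈p∧x≢y⇒x∈p-y y∈W y≢x)

free-petal : ∀ {n d m} {H F : Subset n} {ℱ C : List (Subset n)} →
  Sunflower ℱ → F ∈ ℱ → ∣ H ∣ ≤ m → d * (m ∸ 1) + 2 ≤ length ℱ →
  PairwiseDisjoint C → F ∈ C → All (λ G → ∣ G ∣ ≤ d × Nonempty (G ∩ H)) C →
  ∃ λ F′ → F′ ∈ ℱ × F′ ≢ F × (∀ {G} → G ∈ C → G ≢ F → Disjoint G F′)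
free-petal {d = d} {m} {H} {F} {ℱ} {C} (_ , unique , core , _) F∈ℱ ∣H∣≤m ℱ-large disjoint F∈C hit =
  pick (all? (λ A → nonempty? (A ∩ W)) (ℱ ─ᶜ F))
  where
  W = ⋃ (C ─ᶜ F)

  W∩F=∅ : Disjoint W F
  W∩F=∅ x x∈W with x∈⋃⁻ (C ─ᶜ F) x∈W
  ... | G , G∈C─F , x∈G = let G∈C , G≢F = ∈-─ᶜ⁻ G∈C─F in disjoint G F G∈C F∈C G≢F x x∈G

  meetInF : ∀ {A B} → A ∈ ℱ ─ᶜ F → B ∈ ℱ ─ᶜ F → A ≢ B → A ∩ B ⊆ F
  meetInF {A} {B} A∈ B∈ A≢B x∈A∩B =
    let A∈ℱ , A≢F = ∈-─ᶜ⁻ A∈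
        B∈ℱ , _   = ∈-─ᶜ⁻ B∈
        x∈A∩F = subst (_ ∈ₛ_) (trans (core A B A∈ℱ B∈ℱ A≢B) (sym (core A F A∈ℱ F∈ℱ A≢F))) x∈A∩B
    in proj₂ (x∈p∩q⁻ A F x∈A∩F)

  ∣W∣≤ : ∣ W ∣ ≤ d * (m ∸ 1)
  ∣W∣≤ = begin
    ∣ W ∣              ≤⟨ ∣⋃∣≤d*∣H∣ d (H ─ F) (C ─ᶜ F) disjoint─F hit─F ⟩
    d * ∣ H ─ F ∣      ≤⟨ *-monoʳ-≤ d (∸-monoˡ-≤ 1 ∣H─F∣<m) ⟩
    d * (m ∸ 1)        ∎
    where
    open ≤-Reasoning
    disjoint─F = PairwiseDisjoint-mono (proj₁ ∘ ∈-─ᶜ⁻) disjoint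
    hit─F : All (λ G → ∣ G ∣ ≤ d × Nonempty (G ∩ (H ─ F))) (C ─ᶜ F)
    hit─F = All.tabulate λ G∈C─F →
      let G∈C , G≢F = ∈-─ᶜ⁻ G∈C─F
          ∣G∣≤d , G∩H≠∅ = All.lookup hit G∈C
      in ∣G∣≤d , Nonempty-∩-─ (disjoint _ F G∈C F∈C G≢F) G∩H≠∅
    ∣H─F∣<m : ∣ H ─ F ∣ < m
    ∣H─F∣<m = <-≤-trans (p∩q≢∅⇒∣p─q∣<∣p∣ H F (Nonempty-∩-comm (proj₂ (All.lookup hit F∈C)))) ∣H∣≤m

  pick : Dec (All (λ A → Nonempty (A ∩ W)) (ℱ ─ᶜ F)) →
         ∃ λ F′ → F′ ∈ ℱ × F′ ≢ F × (∀ {G} → G ∈ C → G ≢ F → Disjoint G F′)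
  pick (yes allMeet) = ⊥-elim (<-irrefl refl (begin-strict
    suc (d * (m ∸ 1))           <⟨ ≤-trans (≤-reflexive (+-comm 2 _)) ℱ-large ⟩
    length ℱ                    ≡⟨ length-─ᶜ unique F∈ℱ ⟩
    suc (length (ℱ ─ᶜ F))       ≤⟨ s≤s (length-petals≤∣W∣ F W (ℱ ─ᶜ F) unique─F meetInF W∩F=∅ allMeet) ⟩
    suc ∣ W ∣                   ≤⟨ s≤s ∣W∣≤ ⟩
    suc (d * (m ∸ 1))           ∎))
    where
    open ≤-Reasoning
    unique─F = Unique.filter⁺ _ unique
  pick (no someMiss) =
    let A , A∈ℱ─F , A∩W=∅ = find (¬All⇒Any¬ (λ A → nonempty? (A ∩ W)) (ℱ ─ᶜ F) someMiss)
        A∈ℱ , A≢F = ∈-─ᶜ⁻ A∈ℱ─F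
    in A , A∈ℱ , A≢F , λ G∈C G≢F x x∈G x∈A →
         A∩W=∅ (x , x∈p∩q⁺ (x∈A , x∈⋃⁺ (∈-─ᶜ⁺ G∈C G≢F) x∈G))

module _ {n} {F F′ : Subset n} (A B : List (Subset n)) where

  ++-exchange-⊆ : A ++ F′ ∷ (B ─ᶜ F) ⊆ˡ F′ ∷ (A ++ B)
  ++-exchange-⊆ G∈ with ∈-++⁻ A G∈
  ... | inj₁ G∈A               = there (∈-++⁺ˡ G∈A)
  ... | inj₂ (here refl)       = here refl
  ... | inj₂ (there G∈B─F)     = there (∈-++⁺ʳ A (proj₁ (∈-─ᶜ⁻ G∈B─F)))

  ++-exchange-⊇ : A ++ B ⊆ˡ F ∷ (A ++ F′ ∷ (B ─ᶜ F))
  ++-exchange-⊇ {G} G∈ with ∈-++⁻ A G∈ | G ≟ˢ F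
  ... | inj₁ G∈A | _        = there (∈-++⁺ˡ G∈A)
  ... | inj₂ _   | yes G≡F  = here G≡F
  ... | inj₂ G∈B | no G≢F   = there (∈-++⁺ʳ A (there (∈-─ᶜ⁺ G∈B G≢F)))

  ++-exchange-∉ : F ∉ A → F′ ≢ F → F ∉ A ++ F′ ∷ (B ─ᶜ F)
  ++-exchange-∉ F∉A F′≢F F∈ with ∈-++⁻ A F∈
  ... | inj₁ F∈A           = F∉A F∈A
  ... | inj₂ (here F≡F′)   = F′≢F (sym F≡F′)
  ... | inj₂ (there F∈B─F) = proj₂ (∈-─ᶜ⁻ {C = B} F∈B─F) refl

𝒮-removeSet⁻ : ∀ {I : Instance} {F S} → S ∈ 𝒮 (removeSet I F) → S ∈ 𝒮 I
𝒮-removeSet⁻ = proj₁ ∘ ∈-─ᶜ⁻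

𝒮-removeSet⁺ : ∀ {I : Instance} {F S} → S ∈ 𝒮 I → S ≢ F → S ∈ 𝒮 (removeSet I F)
𝒮-removeSet⁺ = ∈-─ᶜ⁺

Rejects-removeSet : ∀ {I : Instance} {F j X} → Rejects (removeSet I F) j X → Rejects I j X
Rejects-removeSet {I} (Xrej , Xrej⊆X , Xint , internal , disjoint , gain) =
  Xrej , Xrej⊆X , Xint , All.map (map₁ (𝒮-removeSet⁻ {I})) internal , disjoint , gain

record Replacement (I : Instance) (i : Fin (p I)) (F : Subset (n I)) (C : List (Subset (n I))) :
  Set where
  field
    F′       : Subset (n I)
    F′∈𝒮     : F′ ∈ 𝒮 I
    F′≢F     : F′ ≢ F
    F′⊆Uᵢ    : Internal I i F′
    ∣F∣≤∣F′∣ : ∣ F ∣ ≤ ∣ F′ ∣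
    avoids   : ∀ {G} → G ∈ C → G ≢ F → Disjoint G F′

module _ {I : Instance} {i : Fin (p I)} {F : Subset (n I)} (F⊆Uᵢ : Internal I i F)
  (replace : ∀ {C} → C ⊆ˡ 𝒮 I → PairwiseDisjoint C → F ∈ C → Replacement I i F C) where

  module Exchange {X : List (Subset (n I))} (X⊆𝒮 : X ⊆ˡ 𝒮 I) (disjoint : PairwiseDisjoint X)
    (F∈X : F ∈ X) where
    open Replacement (replace X⊆𝒮 disjoint F∈X)

    X′ : List (Subset (n I))
    X′ = F′ ∷ (X ─ᶜ F)

    X′⊆𝒮′ : X′ ⊆ᶜ 𝒮 (removeSet I F)
    X′⊆𝒮′ = 𝒮-removeSet⁺ {I} F′∈𝒮 F′≢F ∷ All.tabulate λ G∈X─F →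
      let G∈X , G≢F = ∈-─ᶜ⁻ G∈X─F in 𝒮-removeSet⁺ {I} (X⊆𝒮 G∈X) G≢F

    X′-disjoint : PairwiseDisjoint X′
    X′-disjoint =
      PairwiseDisjoint-exchange disjoint avoids (++-exchange-⊆ [] X) (++-exchange-∉ [] X (λ ()) F′≢F)

    ∣⋃∩∣-X≤X′ : ∀ {P} → F′ ⊆ P → ∣ ⋃ X ∩ P ∣ ≤ ∣ ⋃ X′ ∩ P ∣
    ∣⋃∩∣-X≤X′ F′⊆P = ∣⋃∩∣-exchange avoids (++-exchange-⊇ [] X) (here refl) F′⊆P ∣F∣≤∣F′∣

    ∣⋃X∣≤∣⋃X′∣ : ∣ ⋃ X ∣ ≤ ∣ ⋃ X′ ∣
    ∣⋃X∣≤∣⋃X′∣ = subst₂ _≤_ (cong ∣_∣ (∩-identityʳ (⋃ X))) (cong ∣_∣ (∩-identityʳ (⋃ X′)))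
      (∣⋃∩∣-X≤X′ (λ _ → ∈⊤))

    covᵢ-X≤X′ : ∀ j → covᵢ I j X ≤ covᵢ I j X′
    covᵢ-X≤X′ j with i FinP.≟ j
    ... | yes refl = ∣⋃∩∣-X≤X′ F′⊆Uᵢ
    ... | no i≢j   = ∣⋃∩∣-mono λ G∈X → case-F (++-exchange-⊇ [] X G∈X)
      where
      case-F : ∀ {G} → G ∈ F ∷ X′ → G ∈ X′ ⊎ Disjoint G (Part I j)
      case-F (here refl)  = inj₂ (Internal⇒Disjoint I F⊆Uᵢ i≢j)
      case-F (there G∈X′) = inj₁ G∈X′

    Rejects-X′⇒Rejects-X : ∀ {j} → Rejects (removeSet I F) j X′ → Rejects I j X
    Rejects-X′⇒Rejects-X {j} (Xrej , _ , Xint , internal′ , disjointC , gain) =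
      split (i FinP.≟ j) (F′ ∈ᶜ? Kept)
      where
      Kept = X′ ∖ᶜ Xrej
      C = Kept ++ Xint
      -- X gives up exactly the sets X′ did not keep, so X ∖ᶜ Xrej₂ is the part of X inside Kept.
      Xrej₂ = X ∖ᶜ Kept
      internal : All (λ S → S ∈ 𝒮 I × Internal I j S) Xint
      internal = All.map (map₁ (𝒮-removeSet⁻ {I})) internal′

      kept : ∀ {G} → G ∈ Kept → G ≡ F′ ⊎ G ∈ (X ∖ᶜ Xrej₂)
      kept G∈Kept with proj₁ (∈-∖ᶜ⁻ {Y = Xrej} G∈Kept)
      ... | here G≡F′   = inj₁ G≡F′
      ... | there G∈X─F = inj₂ (∈-∖ᶜ-∖ᶜ⁺ {K = Kept} (proj₁ (∈-─ᶜ⁻ {C = X} G∈X─F)) G∈Kept)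

      -- F′ is the only kept set that is not in X: it must be re-added or be irrelevant to Uⱼ.
      reject : ∀ Xs → All (λ S → S ∈ 𝒮 I × Internal I j S) Xs → Xs ⊆ˡ C → Xint ⊆ˡ Xs →
        (F′ ∈ Kept → F′ ∈ Xs ⊎ Disjoint F′ (Part I j)) → Rejects I j X
      reject Xs internalXs Xs⊆C Xint⊆Xs F′-covered = Xrej₂ , ∖ᶜ-⊆ᶜ X Kept , Xs , internalXs ,
        PairwiseDisjoint-mono C₂⊆C disjointC ,
        <-≤-trans (≤-<-trans (covᵢ-X≤X′ j) gain) (∣⋃∩∣-mono C⊆C₂)
        where
        C₂⊆C : (X ∖ᶜ Xrej₂) ++ Xs ⊆ˡ C
        C₂⊆C G∈ with ∈-++⁻ (X ∖ᶜ Xrej₂) G∈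
        ... | inj₁ G∈X∖Xrej₂ = ∈-++⁺ˡ (∈-∖ᶜ-∖ᶜ⁻ {X = X} G∈X∖Xrej₂)
        ... | inj₂ G∈Xs      = Xs⊆C G∈Xs
        C⊆C₂ : ∀ {G} → G ∈ C → G ∈ (X ∖ᶜ Xrej₂) ++ Xs ⊎ Disjoint G (Part I j)
        C⊆C₂ G∈ with ∈-++⁻ Kept G∈
        ... | inj₂ G∈Xint = inj₁ (∈-++⁺ʳ (X ∖ᶜ Xrej₂) (Xint⊆Xs G∈Xint))
        ... | inj₁ G∈Kept with kept G∈Kept
        ...   | inj₁ refl      = Sum.map₁ (∈-++⁺ʳ (X ∖ᶜ Xrej₂)) (F′-covered G∈Kept)
        ...   | inj₂ G∈X∖Xrej₂ = inj₁ (∈-++⁺ˡ G∈X∖Xrej₂)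

      split : Dec (i ≡ j) → Dec (F′ ∈ Kept) → Rejects I j X
      split (yes refl) (yes F′∈Kept) =
        reject (F′ ∷ Xint) ((F′∈𝒮 , F′⊆Uᵢ) ∷ internal) F′∷Xint⊆C there (λ _ → inj₁ (here refl))
        where
        F′∷Xint⊆C : F′ ∷ Xint ⊆ˡ C
        F′∷Xint⊆C (here refl)    = ∈-++⁺ˡ F′∈Kept
        F′∷Xint⊆C (there G∈Xint) = ∈-++⁺ʳ Kept G∈Xint
      split (yes refl) (no F′∉Kept) =
        reject Xint internal (∈-++⁺ʳ Kept) (λ G∈ → G∈) (⊥-elim ∘ F′∉Kept)
      split (no i≢j) _ =
        reject Xint internal (∈-++⁺ʳ Kept) (λ G∈ → G∈) (λ _ → inj₂ (Internal⇒Disjoint I F′⊆Uᵢ i≢j))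

  internal-removeSet⁺ : ∀ {j S} → S ≢ F → S ∈ 𝒮 I × Internal I j S →
    S ∈ 𝒮 (removeSet I F) × Internal (removeSet I F) j S
  internal-removeSet⁺ S≢F = map₁ λ S∈𝒮 → 𝒮-removeSet⁺ {I} S∈𝒮 S≢F

  YesInstance-removeSet⁺ : YesInstance I → YesInstance (removeSet I F)
  YesInstance-removeSet⁺ (X , X⊆𝒮 , disjoint , rejection-proof , large) with F ∈ᶜ? X
  ... | no F∉X = X , X⊆𝒮′ , disjoint , (λ j → rejection-proof j ∘ Rejects-removeSet {I}) , large
    where
    X⊆𝒮′ : X ⊆ᶜ 𝒮 (removeSet I F)
    X⊆𝒮′ = All.tabulate λ G∈X → 𝒮-removeSet⁺ {I} (All.lookup X⊆𝒮 G∈X) λ { refl → F∉X G∈X }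
  ... | yes F∈X = X′ , X′⊆𝒮′ , X′-disjoint , (λ j → rejection-proof j ∘ Rejects-X′⇒Rejects-X) ,
                  ≤-trans large ∣⋃X∣≤∣⋃X′∣
    where open Exchange (All.lookup X⊆𝒮) disjoint F∈X

  Rejects⇒Rejects-removeSet : Nonempty F → ∀ {X j} → X ⊆ˡ 𝒮 (removeSet I F) →
    Rejects I j X → Rejects (removeSet I F) j X
  Rejects⇒Rejects-removeSet F≠∅ {X} {j} X⊆𝒮′ (Xrej , Xrej⊆X , Xint , internal , disjointC , gain)
    with F ∈ᶜ? Xint
  ... | no F∉Xint = Xrej , Xrej⊆X , Xint , internal′ , disjointC , gain
    where
    internal′ = All.tabulate λ S∈Xint →
      internal-removeSet⁺ (λ { refl → F∉Xint S∈Xint }) (All.lookup internal S∈Xint)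
  ... | yes F∈Xint = Xrej , Xrej⊆X , F′ ∷ (Xint ─ᶜ F) , internal′ , disjoint′ , <-≤-trans gain gain′
    where
    Kept = X ∖ᶜ Xrej
    C⊆𝒮 : Kept ++ Xint ⊆ˡ 𝒮 I
    C⊆𝒮 G∈ with ∈-++⁻ Kept G∈
    ... | inj₁ G∈Kept = 𝒮-removeSet⁻ {I} (X⊆𝒮′ (proj₁ (∈-∖ᶜ⁻ {Y = Xrej} G∈Kept)))
    ... | inj₂ G∈Xint = proj₁ (All.lookup internal G∈Xint)
    open Replacement (replace C⊆𝒮 disjointC (∈-++⁺ʳ Kept F∈Xint))
    i≡j : i ≡ j
    i≡j = let x , x∈F = F≠∅ in ∈Part-unique I (F⊆Uᵢ x∈F) (proj₂ (All.lookup internal F∈Xint) x∈F)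
    F′⊆Uⱼ : Internal I j F′
    F′⊆Uⱼ = subst (λ t → Internal I t F′) i≡j F′⊆Uᵢ
    internal′ : All (λ S → S ∈ 𝒮 (removeSet I F) × Internal (removeSet I F) j S) (F′ ∷ (Xint ─ᶜ F))
    internal′ = internal-removeSet⁺ F′≢F (F′∈𝒮 , F′⊆Uⱼ) ∷ All.tabulate λ S∈Xint─F →
      let S∈Xint , S≢F = ∈-─ᶜ⁻ S∈Xint─F in internal-removeSet⁺ S≢F (All.lookup internal S∈Xint)
    F∉Kept : F ∉ Kept
    F∉Kept F∈Kept = proj₂ (∈-─ᶜ⁻ {C = 𝒮 I} (X⊆𝒮′ (proj₁ (∈-∖ᶜ⁻ {Y = Xrej} F∈Kept)))) refl
    disjoint′ = PairwiseDisjoint-exchange disjointC avoids (++-exchange-⊆ Kept Xint)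
                  (++-exchange-∉ Kept Xint F∉Kept F′≢F)
    gain′ = ∣⋃∩∣-exchange avoids (++-exchange-⊇ Kept Xint) (∈-++⁺ʳ Kept (here refl)) F′⊆Uⱼ ∣F∣≤∣F′∣

  YesInstance-removeSet⁻ : Nonempty F → YesInstance (removeSet I F) → YesInstance I
  YesInstance-removeSet⁻ F≠∅ (X , X⊆𝒮′ , disjoint , rejection-proof′ , large) =
    X , All.map (𝒮-removeSet⁻ {I}) X⊆𝒮′ , disjoint ,
    (λ j → rejection-proof′ j ∘ Rejects⇒Rejects-removeSet F≠∅ (All.lookup X⊆𝒮′)) , large

replacement : ∀ {d} {I : Instance} → SizeBounded d I → ∀ {H} → HittingSet I H → ∣ H ∣ ≤ k I * d →
  ∀ {i ℱ} → InRestriction I i ℱ → Sunflower ℱ → length ℱ ≡ d * (k I * d ∸ 1) + 2 →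
  ∀ {F} → MinIn F ℱ → ∀ {C} → C ⊆ˡ 𝒮 I → PairwiseDisjoint C → F ∈ C → Replacement I i F C
replacement bounded hitting ∣H∣≤kd ℱ⊆𝒮[Uᵢ] sunflower ℱ-size (F∈ℱ , F-min) C⊆𝒮 disjoint F∈C
  with free-petal sunflower F∈ℱ ∣H∣≤kd (≤-reflexive (sym ℱ-size)) disjoint F∈C
         (All.tabulate λ G∈C → All.lookup bounded (C⊆𝒮 G∈C) , All.lookup hitting (C⊆𝒮 G∈C))
... | F′ , F′∈ℱ , F′≢F , avoids = record
  { F′ = F′ ; F′∈𝒮 = proj₁ (All.lookup ℱ⊆𝒮[Uᵢ] F′∈ℱ) ; F′≢F = F′≢F
  ; F′⊆Uᵢ = proj₂ (All.lookup ℱ⊆𝒮[Uᵢ] F′∈ℱ) ; ∣F∣≤∣F′∣ = All.lookup F-min F′∈ℱ ; avoids = avoids }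

lemma9 : (d : ℕ) (I : Instance) → SizeBounded d I →
         Σ (Subset (n I)) (λ H → HittingSet I H × ∣ H ∣ ≤ k I * d) →
         (i : Fin (p I)) (ℱ : List (Subset (n I))) → InRestriction I i ℱ →
         Sunflower ℱ → length ℱ ≡ d * (k I * d ∸ 1) + 2 →
         (F : Subset (n I)) → MinIn F ℱ →
         YesInstance I ⇔ YesInstance (removeSet I F)
lemma9 d I bounded (H , hitting , ∣H∣≤kd) i ℱ ℱ⊆𝒮[Uᵢ] sunflower ℱ-size F F-min =
  mk⇔ (YesInstance-removeSet⁺ F⊆Uᵢ replace) (YesInstance-removeSet⁻ F⊆Uᵢ replace F≠∅)
  where
  F∈ℱ = proj₁ F-min
  F⊆Uᵢ = proj₂ (All.lookup ℱ⊆𝒮[Uᵢ] F∈ℱ)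
  F≠∅ = let x , x∈F , _ = All.lookup (proj₂ (proj₂ (proj₂ sunflower))) F∈ℱ in x , x∈F
  replace = replacement bounded hitting ∣H∣≤kd ℱ⊆𝒮[Uᵢ] sunflower ℱ-size F-min
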